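{- For any weak composition $\mathbf{a}=(a_1,\dots,a_n)$, the key diagram $\mathbb{D}(\mathtt{sort}(\mathbf{a}))$ is the unique minimal element of $\mathcal{P}(\mathbb{D}(\mathbf{a}))$.
   Context: A diagram is a finite set $D$ of cells $(r,c)$ with $r,c$ positive integers; $r$ is the row (rows numbered from bottom to top starting at 1) and $c$ the column (numbered from left to right starting at 1). A Kohnert move at row $r$ applied to a diagram $D$: if row $r$ of $D$ is empty, $D$ is unchanged; otherwise let $(r,c)$ be the cell of row $r$ with the largest column index; if every position $(r',c)$ with $1\le r'<r$ belongs to $D$, then $D$ is unchanged; otherwise let $r'$ be the largest integer with $1\le r'<r$ and $(r',c)\notin D$, and the move replaces the cell $(r,c)$ by $(r',c)$. For a diagram $D_0$, $KD(D_0)$ is the set of all diagrams obtainable from $D_0$ by finite (possibly empty) sequences of Kohnert moves; the Kohnert poset $\mathcal{P}(D_0)$ is $KD(D_0)$ ordered by $D_2\preceq D_1$ iff $D_2$ can be obtained from $D_1$ by a finite sequence of Kohnert moves. For a weak composition $\mathbf{a}=(a_1,\dots,a_n)\in\mathbb{Z}_{\ge0}^n$, the key diagram is $\mathbb{D}(\mathbf{a})=\bigcup_{i=1}^n\{(i,j):1\le j\le a_i\}$, and $\mathtt{sort}(\mathbf{a})$ is the weakly decreasing sequence obtained by reordering the entries of $\mathbf{a}$. -}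

module Defs where

open import Data.Nat using (ℕ; zero; suc; _⊔_; _≤_)
open import Data.Nat.Properties using (≤-decTotalOrder)
import Data.Nat.Properties as ℕₚ
open import Data.Bool using (Bool; true; false; if_then_else_)
open import Data.Product using (_×_; _,_; proj₁; proj₂; Σ)
open import Data.List using (List; []; _∷_; map; filter; foldr; _++_; reverse; upTo; concat; length)
open import Data.List.Membership.Propositional using (_∈_)
import Data.Product.Properties
open import Data.List.Membership.DecPropositional (Data.Product.Properties.≡-dec ℕₚ._≟_ ℕₚ._≟_) using () renaming (_∈?_ to _∈?ᶜ_)
open import Data.Maybe using (Maybe; just; nothing)
open import Relation.Nullary using (¬_; Dec; yes; no)
open import Relation.Nullary.Decidable using (⌊_⌋; ¬?)
open import Relation.Binary.PropositionalEquality using (_≡_)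
open import Function.Bundles using (_⇔_)
import Data.List.Sort.InsertionSort

-- A cell is (r , c): r = row (counted from the bottom, starting at 1),
-- c = column (from the left, starting at 1).
-- A diagram is a finite set of cells, represented by a list of cells;
-- two lists represent the same diagram iff they have the same members.

Cell : Set
Cell = ℕ × ℕ

Diagram : Set
Diagram = List Cell

infix 4 _≐_
_≐_ : Diagram → Diagram → Set
D ≐ E = ∀ (x : Cell) → (x ∈ D) ⇔ (x ∈ E)

rowCols : ℕ → Diagram → List ℕ
rowCols r D = map proj₂ (filter (λ x → proj₁ x ℕₚ.≟ r) D)

maxList : List ℕ → Maybe ℕ
maxList []       = nothing
maxList (x ∷ xs) with maxList xs
... | nothing = just x
... | just m  = just (x ⊔ m)

emptyBelow : ℕ → ℕ → Diagram → Maybe ℕ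
emptyBelow zero    c D = nothing
emptyBelow (suc k) c D with (suc k , c) ∈?ᶜ D
... | no  _ = just (suc k)
... | yes _ = emptyBelow k c D

removeCell : Cell → Diagram → Diagram
removeCell x D = filter (λ y → ¬? (Data.Product.Properties.≡-dec ℕₚ._≟_ ℕₚ._≟_ y x)) D

kohnertMove : ℕ → Diagram → Diagram
kohnertMove r D with maxList (rowCols r D)
... | nothing = D
... | just c with emptyBelow (r Data.Nat.∸ 1) c D
...   | nothing = D
...   | just r' = (r' , c) ∷ removeCell (r , c) D

infix 4 _⇝_
data _⇝_ : Diagram → Diagram → Set where
  done : ∀ {D E} → D ≐ E → D ⇝ E
  step : ∀ {D E} (r : ℕ) → kohnertMove r D ⇝ E → D ⇝ E

_∈KD_ : Diagram → Diagram → Set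
E ∈KD D₀ = D₀ ⇝ E

_⪯_ : Diagram → Diagram → Set
D₂ ⪯ D₁ = D₁ ⇝ D₂

IsMinimal : Diagram → Diagram → Set
IsMinimal D₀ M = M ∈KD D₀ × (∀ F → F ∈KD D₀ → F ⪯ M → F ≐ M)

IsUniqueMinimal : Diagram → Diagram → Set
IsUniqueMinimal D₀ M = IsMinimal D₀ M × (∀ E → IsMinimal D₀ E → E ≐ M)

WeakComposition : Set
WeakComposition = List ℕ

rowCells : ℕ → ℕ → List Cell
rowCells i a = map (λ j → (i , suc j)) (upTo a)

keyFrom : ℕ → WeakComposition → Diagram
keyFrom i []       = []
keyFrom i (a ∷ as) = rowCells i a ++ keyFrom (suc i) as

keyDiagram : WeakComposition → Diagram
keyDiagram = keyFrom 1

sortDesc : WeakComposition → WeakComposition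
sortDesc a = reverse (Data.List.Sort.InsertionSort.sort ≤-decTotalOrder a)

-- Kohnert moves preserve the number of cells in every column and strictly lower the sum of the
-- row indices, so from 𝔻(a) one reaches diagrams fixed by every move, and the minimal elements
-- of the poset are exactly such fixed diagrams. A diagram is fixed iff each column is full below
-- the rightmost cell of every row. Since column c of 𝔻(a) has #{i : aᵢ ≥ c} cells, a number
-- weakly decreasing in c, a gap below a cell of column c in a fixed diagram would leave column c
-- shorter than the column of the rightmost cell in that cell's row; hence every fixed diagram has column c equal to the
-- rows 1, …, #{i : aᵢ ≥ c}, which is 𝔻(sort(a)).

module Submission where

open import Defs
open import Data.Bool using (if_then_else_)
open import Data.Nat
open import Data.Nat.Properties
open import Data.Nat.Induction using (<-wellFounded)
open import Data.Nat.ListAction using (sum)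
open import Data.Product using (_×_; _,_; proj₁; proj₂; ∃-syntax)
open import Data.Product.Properties using (≡-dec)
open import Data.Sum using (_⊎_; inj₁; inj₂)
open import Data.Maybe using (just; nothing)
open import Data.List using (List; []; _∷_; map; filter; length; reverse)
open import Data.List.Properties using (filter-accept; filter-reject; unfold-reverse)
import Data.List.Properties as List
open import Data.List.Membership.Propositional using (_∈_; _∉_; find)
open import Data.List.Membership.Propositional.Properties
  using (∈-map⁺; ∈-map⁻; ∈-filter⁺; ∈-filter⁻; ∈-++⁺ˡ; ∈-++⁺ʳ; ∈-++⁻; ∈-upTo⁺; ∈-upTo⁻)
open import Data.List.Membership.DecPropositional _≟_ using (_∈?_)
open import Data.List.Membership.DecPropositional (≡-dec _≟_ _≟_) using () renaming (_∈?_ to _∈?ᶜ_)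
open import Data.List.Relation.Unary.Any using (here; there)
import Data.List.Relation.Unary.Any.Properties as Any
open import Data.List.Relation.Unary.All using (all?)
import Data.List.Relation.Unary.All as All
open import Data.List.Relation.Unary.All.Properties using (¬All⇒Any¬)
open import Data.List.Relation.Unary.AllPairs using (AllPairs; []; _∷_)
import Data.List.Relation.Unary.AllPairs.Properties as AllPairs
open import Data.List.Relation.Unary.Linked.Properties using (Linked⇒AllPairs)
open import Data.List.Relation.Binary.Sublist.Propositional using (⊆-refl)
import Data.List.Relation.Binary.Sublist.Propositional.Properties as Sublist
open import Data.List.Relation.Binary.Permutation.Propositional using (_↭_; ↭-trans)
open import Data.List.Relation.Binary.Permutation.Propositional.Properties using (↭-length; filter-↭; ↭-reverse)
import Data.List.Sort.InsertionSort.Properties as Sort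
open import Function using (_∘_; _on_; flip)
open import Function.Bundles using (_⇔_; mk⇔; Equivalence)
import Function.Properties.Equivalence as ⇔
open import Induction.WellFounded using (Acc; acc)
open import Relation.Nullary using (Dec; yes; no; contradiction)
open import Relation.Nullary.Decidable using (⌊_⌋; ¬?)
open import Relation.Binary.PropositionalEquality
open import Relation.Binary.Definitions using (tri<; tri≈; tri>)
import Relation.Binary.Construct.On as On

-- Sums over ranges

sumFrom : (ℕ → ℕ) → ℕ → ℕ → ℕ
sumFrom f lo zero    = 0
sumFrom f lo (suc n) = f lo + sumFrom f (suc lo) n

private
  lo<lo+suc : ∀ lo n → lo < lo + suc n
  lo<lo+suc lo n = m<m+n lo z<s

  <-shift : ∀ {s} lo n → s < suc lo + n → s < lo + suc n
  <-shift {s} lo n = subst (s <_) (sym (+-suc lo n))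

sumFrom-cong : ∀ {f g} lo n → (∀ {s} → lo ≤ s → s < lo + n → f s ≡ g s) →
               sumFrom f lo n ≡ sumFrom g lo n
sumFrom-cong lo zero    _  = refl
sumFrom-cong lo (suc n) eq = cong₂ _+_ (eq ≤-refl (lo<lo+suc lo n))
  (sumFrom-cong (suc lo) n (λ lo<s s<hi → eq (<⇒≤ lo<s) (<-shift lo n s<hi)))

_[_≔_] : (ℕ → ℕ) → ℕ → ℕ → ℕ → ℕ
(f [ p ≔ v ]) s with s ≟ p
... | yes _ = v
... | no  _ = f s

update-≡ : ∀ f p v → (f [ p ≔ v ]) p ≡ v
update-≡ f p v with p ≟ p
... | yes _  = refl
... | no p≢p = contradiction refl p≢p

update-≢ : ∀ f {p s} v → s ≢ p → (f [ p ≔ v ]) s ≡ f s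
update-≢ f {p} {s} v s≢p with s ≟ p
... | yes s≡p = contradiction s≡p s≢p
... | no  _   = refl

sumFrom-update : ∀ f {p} v lo n → lo ≤ p → p < lo + n →
                 sumFrom (f [ p ≔ v ]) lo n + f p ≡ sumFrom f lo n + v
sumFrom-update f v lo zero    lo≤p p<lo = contradiction (subst (_ <_) (+-identityʳ lo) p<lo) (≤⇒≯ lo≤p)
sumFrom-update f {p} v lo (suc n) lo≤p p<hi with m≤n⇒m<n∨m≡n lo≤p
... | inj₂ refl = begin
  (f [ lo ≔ v ]) lo + sumFrom (f [ lo ≔ v ]) (suc lo) n + f lo
    ≡⟨ cong₂ (λ x y → x + y + f lo) (update-≡ f lo v) (sumFrom-cong (suc lo) n (λ lo<s _ → update-≢ f v (>⇒≢ lo<s))) ⟩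
  v + sumFrom f (suc lo) n + f lo
    ≡⟨ +-comm (v + _) (f lo) ⟩
  f lo + (v + sumFrom f (suc lo) n)
    ≡⟨ cong (f lo +_) (+-comm v _) ⟩
  f lo + (sumFrom f (suc lo) n + v)
    ≡⟨ +-assoc (f lo) _ v ⟨
  f lo + sumFrom f (suc lo) n + v ∎
  where open ≡-Reasoning
... | inj₁ lo<p = begin
  (f [ p ≔ v ]) lo + sumFrom (f [ p ≔ v ]) (suc lo) n + f p
    ≡⟨ +-assoc ((f [ p ≔ v ]) lo) _ (f p) ⟩
  (f [ p ≔ v ]) lo + (sumFrom (f [ p ≔ v ]) (suc lo) n + f p)
    ≡⟨ cong₂ _+_ (update-≢ f v (<⇒≢ lo<p)) (sumFrom-update f v (suc lo) n lo<p (subst (p <_) (+-suc lo n) p<hi)) ⟩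
  f lo + (sumFrom f (suc lo) n + v)
    ≡⟨ +-assoc (f lo) _ v ⟨
  f lo + sumFrom f (suc lo) n + v ∎
  where open ≡-Reasoning

sumFrom-transpose : ∀ f {p q} lo n → lo ≤ p → p < lo + n → lo ≤ q → q < lo + n → q ≢ p →
                    sumFrom (f [ p ≔ f q ] [ q ≔ f p ]) lo n ≡ sumFrom f lo n
sumFrom-transpose f {p} {q} lo n lo≤p p<hi lo≤q q<hi q≢p = +-cancelʳ-≡ (f q) _ _ (begin
  sumFrom (g [ q ≔ f p ]) lo n + f q ≡⟨ cong (sumFrom (g [ q ≔ f p ]) lo n +_) (update-≢ f (f q) q≢p) ⟨
  sumFrom (g [ q ≔ f p ]) lo n + g q ≡⟨ sumFrom-update g (f p) lo n lo≤q q<hi ⟩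
  sumFrom g lo n + f p               ≡⟨ sumFrom-update f (f q) lo n lo≤p p<hi ⟩
  sumFrom f lo n + f q               ∎)
  where
  open ≡-Reasoning
  g : ℕ → ℕ
  g = f [ p ≔ f q ]

sumFrom-≥ : ∀ f lo n k → k ≤ n → (∀ {s} → lo ≤ s → s < lo + k → 1 ≤ f s) → k ≤ sumFrom f lo n
sumFrom-≥ f lo n       zero    _         _   = z≤n
sumFrom-≥ f lo (suc n) (suc k) (s≤s k≤n) pos = +-mono-≤ (pos ≤-refl (lo<lo+suc lo k))
  (sumFrom-≥ f (suc lo) n k k≤n (λ lo<s s<hi → pos (<⇒≤ lo<s) (<-shift lo k s<hi)))

sumFrom-≤ : ∀ f lo n k → (∀ s → f s ≤ 1) → (∀ {s} → lo + k ≤ s → f s ≡ 0) → sumFrom f lo n ≤ k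
sumFrom-≤ f lo zero    k       _  _      = z≤n
sumFrom-≤ f lo (suc n) zero    ≤1 vanish = subst (λ x → x + sumFrom f (suc lo) n ≤ 0) (sym (vanish (≤-reflexive (+-identityʳ lo))))
  (sumFrom-≤ f (suc lo) n zero ≤1 (λ hi≤s → vanish (≤-trans (n≤1+n (lo + 0)) hi≤s)))
sumFrom-≤ f lo (suc n) (suc k) ≤1 vanish = +-mono-≤ (≤1 lo)
  (sumFrom-≤ f (suc lo) n k ≤1 (λ {s} hi≤s → vanish {s} (subst (_≤ s) (sym (+-suc lo k)) hi≤s)))

-- Kohnert moves

≐-refl : ∀ {D} → D ≐ D
≐-refl _ = ⇔.refl

≐-sym : ∀ {D E} → D ≐ E → E ≐ D
≐-sym D≐E x = ⇔.sym (D≐E x)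

≐-trans : ∀ {D E F} → D ≐ E → E ≐ F → D ≐ F
≐-trans D≐E E≐F x = ⇔.trans (D≐E x) (E≐F x)

≐-reflexive : ∀ {D E} → D ≡ E → D ≐ E
≐-reflexive refl = ≐-refl

∈-resp-≐ : ∀ {D E x} → D ≐ E → x ∈ D → x ∈ E
∈-resp-≐ {x = x} D≐E = Equivalence.to (D≐E x)

∈-rowCols⁻ : ∀ {r c} D → c ∈ rowCols r D → (r , c) ∈ D
∈-rowCols⁻ {r} D c∈ with ∈-map⁻ proj₂ c∈
... | (_ , _) , x∈ , refl with ∈-filter⁻ (λ y → proj₁ y ≟ r) {xs = D} x∈
... | x∈D , refl = x∈D

∈-rowCols⁺ : ∀ {r c D} → (r , c) ∈ D → c ∈ rowCols r D
∈-rowCols⁺ {r} x∈D = ∈-map⁺ proj₂ (∈-filter⁺ (λ y → proj₁ y ≟ r) x∈D refl)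

maxList-nothing : ∀ xs → maxList xs ≡ nothing → ∀ {y} → y ∉ xs
maxList-nothing (x ∷ xs) eq with maxList xs
maxList-nothing (x ∷ xs) () | nothing
maxList-nothing (x ∷ xs) () | just _

maxList-just : ∀ xs {m} → maxList xs ≡ just m → m ∈ xs × (∀ {y} → y ∈ xs → y ≤ m)
maxList-just (x ∷ xs) eq with maxList xs in eq′
maxList-just (x ∷ xs) refl | nothing = here refl , λ where
  (here refl) → ≤-refl
  (there y∈)  → contradiction y∈ (maxList-nothing xs eq′)
maxList-just (x ∷ xs) refl | just m with maxList-just xs eq′
... | m∈ , ≤m = max∈ , ≤max
  where
  max∈ : x ⊔ m ∈ x ∷ xs
  max∈ with ⊔-sel x m
  ... | inj₁ x⊔m≡x = here x⊔m≡x
  ... | inj₂ x⊔m≡m = there (subst (_∈ xs) (sym x⊔m≡m) m∈)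
  ≤max : ∀ {y} → y ∈ x ∷ xs → y ≤ x ⊔ m
  ≤max (here refl) = m≤m⊔n x m
  ≤max (there y∈)  = ≤-trans (≤m y∈) (m≤n⊔m x m)

emptyBelow-nothing : ∀ k c D → emptyBelow k c D ≡ nothing → ∀ {s} → 1 ≤ s → s ≤ k → (s , c) ∈ D
emptyBelow-nothing zero    c D eq 1≤s s≤0 = contradiction s≤0 (<⇒≱ 1≤s)
emptyBelow-nothing (suc k) c D eq {s} 1≤s s≤k with (suc k , c) ∈?ᶜ D
emptyBelow-nothing (suc k) c D () 1≤s s≤k | no _
... | yes top∈D with m≤n⇒m<n∨m≡n s≤k
... | inj₁ s<k  = emptyBelow-nothing k c D eq 1≤s (≤-pred s<k)
... | inj₂ refl = top∈D

record TopGap (k c : ℕ) (D : Diagram) (r′ : ℕ) : Set where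
  field
    positive  : 1 ≤ r′
    bounded   : r′ ≤ k
    empty     : (r′ , c) ∉ D
    fullAbove : ∀ {s} → r′ < s → s ≤ k → (s , c) ∈ D

emptyBelow-just : ∀ k c D {r′} → emptyBelow k c D ≡ just r′ → TopGap k c D r′
emptyBelow-just (suc k) c D eq with (suc k , c) ∈?ᶜ D
emptyBelow-just (suc k) c D refl | no top∉D = record
  { positive = s≤s z≤n ; bounded = ≤-refl ; empty = top∉D
  ; fullAbove = λ r′<s s≤k → contradiction s≤k (<⇒≱ r′<s) }
... | yes top∈D = record
  { positive = positive ; bounded = m≤n⇒m≤1+n bounded ; empty = empty ; fullAbove = fullAbove′ }
  where
  open TopGap (emptyBelow-just k c D eq)
  fullAbove′ : ∀ {s} → _ < s → s ≤ suc k → (s , c) ∈ D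
  fullAbove′ r′<s s≤k with m≤n⇒m<n∨m≡n s≤k
  ... | inj₁ s<k  = fullAbove r′<s (≤-pred s<k)
  ... | inj₂ refl = top∈D

IsRowMax : Diagram → ℕ → ℕ → Set
IsRowMax D r c = (r , c) ∈ D × (∀ {c′} → (r , c′) ∈ D → c′ ≤ c)

data MoveView (r : ℕ) (D : Diagram) : Diagram → Set where
  emptyRow : (∀ {c} → (r , c) ∉ D) → MoveView r D D
  blocked  : ∀ {c} → IsRowMax D r c → (∀ {s} → 1 ≤ s → s < r → (s , c) ∈ D) → MoveView r D D
  moves    : ∀ {c r′} → IsRowMax D r c → 1 ≤ r′ → r′ < r → (r′ , c) ∉ D →
             (∀ {s} → r′ < s → s < r → (s , c) ∈ D) →
             MoveView r D ((r′ , c) ∷ removeCell (r , c) D)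

private
  <⇒≤∸1 : ∀ {s r} → s < r → s ≤ r ∸ 1
  <⇒≤∸1 (s≤s s≤r) = s≤r

  ≤∸1⇒< : ∀ {s r} → 1 ≤ s → s ≤ r ∸ 1 → s < r
  ≤∸1⇒< {r = zero}  (s≤s _) ()
  ≤∸1⇒< {r = suc r} _ s≤r = s≤s s≤r

rowMax-maxList : ∀ {r c} D → maxList (rowCols r D) ≡ just c → IsRowMax D r c
rowMax-maxList D eq with maxList-just (rowCols _ D) eq
... | c∈ , ≤c = ∈-rowCols⁻ D c∈ , λ r,c′∈D → ≤c (∈-rowCols⁺ r,c′∈D)

moveView : ∀ r D → MoveView r D (kohnertMove r D)
moveView r D with maxList (rowCols r D) in eq
... | nothing = emptyRow (λ r,c∈D → maxList-nothing (rowCols r D) eq (∈-rowCols⁺ r,c∈D))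
... | just c with emptyBelow (r ∸ 1) c D in eq′
... | nothing = blocked (rowMax-maxList D eq) (λ 1≤s s<r → emptyBelow-nothing (r ∸ 1) c D eq′ 1≤s (<⇒≤∸1 s<r))
... | just r′ = moves (rowMax-maxList D eq) positive (≤∸1⇒< positive bounded) empty (λ r′<s s<r → fullAbove r′<s (<⇒≤∸1 s<r))
  where
  open TopGap (emptyBelow-just (r ∸ 1) c D eq′)

∈-removeCell⁻ : ∀ {x y} D → x ∈ removeCell y D → x ∈ D × x ≢ y
∈-removeCell⁻ {y = y} D = ∈-filter⁻ (λ z → ¬? (≡-dec _≟_ _≟_ z y)) {xs = D}

∈-removeCell⁺ : ∀ {x y D} → x ∈ D → x ≢ y → x ∈ removeCell y D
∈-removeCell⁺ {y = y} = ∈-filter⁺ (λ z → ¬? (≡-dec _≟_ _≟_ z y))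

∈-moved⁻ : ∀ {x p q} D → x ∈ p ∷ removeCell q D → x ≡ p ⊎ (x ∈ D × x ≢ q)
∈-moved⁻ D (here x≡p) = inj₁ x≡p
∈-moved⁻ D (there x∈) = inj₂ (∈-removeCell⁻ D x∈)

∈-moved⁺ : ∀ {x p q D} → x ≡ p ⊎ (x ∈ D × x ≢ q) → x ∈ p ∷ removeCell q D
∈-moved⁺ (inj₁ x≡p)          = here x≡p
∈-moved⁺ (inj₂ (x∈D , x≢q)) = there (∈-removeCell⁺ x∈D x≢q)

moved-cong : ∀ {D D′} p q → D ≐ D′ → p ∷ removeCell q D ≐ p ∷ removeCell q D′
moved-cong {D} {D′} p q D≐D′ x = mk⇔ (transport D≐D′) (transport (≐-sym D≐D′))
  where
  transport : ∀ {E E′} → E ≐ E′ → x ∈ p ∷ removeCell q E → x ∈ p ∷ removeCell q E′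
  transport {E} {E′} E≐E′ x∈ with ∈-moved⁻ E x∈
  ... | inj₁ x≡p          = ∈-moved⁺ {D = E′} (inj₁ x≡p)
  ... | inj₂ (x∈E , x≢q) = ∈-moved⁺ {D = E′} (inj₂ (∈-resp-≐ E≐E′ x∈E , x≢q))

rowMax-unique : ∀ {D D′ r c c′} → D ≐ D′ → IsRowMax D r c → IsRowMax D′ r c′ → c ≡ c′
rowMax-unique D≐D′ (c∈ , ≤c) (c′∈ , ≤c′) = ≤-antisym (≤c′ (∈-resp-≐ D≐D′ c∈)) (≤c (∈-resp-≐ (≐-sym D≐D′) c′∈))

rowMax-exists : ∀ {D r c} → (r , c) ∈ D → ∃[ d ] IsRowMax D r d × c ≤ d
rowMax-exists {D} {r} r,c∈D with kohnertMove r D | moveView r D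
... | _ | emptyRow ∉D           = contradiction r,c∈D ∉D
... | _ | blocked {d} max _     = d , max , proj₂ max r,c∈D
... | _ | moves {d} max _ _ _ _ = d , max , proj₂ max r,c∈D

moveView-cong : ∀ {r D D′ R R′} → D ≐ D′ → MoveView r D R → MoveView r D′ R′ → R ≐ R′
moveView-cong D≐D′ (emptyRow _) (emptyRow _) = D≐D′
moveView-cong D≐D′ (emptyRow ∉D) (blocked (c∈ , _) _) = contradiction (∈-resp-≐ (≐-sym D≐D′) c∈) ∉D
moveView-cong D≐D′ (emptyRow ∉D) (moves (c∈ , _) _ _ _ _) = contradiction (∈-resp-≐ (≐-sym D≐D′) c∈) ∉D
moveView-cong D≐D′ (blocked (c∈ , _) _) (emptyRow ∉D′) = contradiction (∈-resp-≐ D≐D′ c∈) ∉D′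
moveView-cong D≐D′ (blocked _ _) (blocked _ _) = D≐D′
moveView-cong D≐D′ (blocked max full) (moves max′ 1≤r′ r′<r gap _) with rowMax-unique D≐D′ max max′
... | refl = contradiction (∈-resp-≐ D≐D′ (full 1≤r′ r′<r)) gap
moveView-cong D≐D′ (moves (c∈ , _) _ _ _ _) (emptyRow ∉D′) = contradiction (∈-resp-≐ D≐D′ c∈) ∉D′
moveView-cong D≐D′ (moves max 1≤r′ r′<r gap _) (blocked max′ full′) with rowMax-unique D≐D′ max max′
... | refl = contradiction (∈-resp-≐ (≐-sym D≐D′) (full′ 1≤r′ r′<r)) gap
moveView-cong D≐D′ (moves {r′ = r₁} max _ r₁<r gap₁ full₁) (moves {r′ = r₂} max′ _ r₂<r gap₂ full₂)
  with rowMax-unique D≐D′ max max′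
... | refl with <-cmp r₁ r₂
... | tri< r₁<r₂ _ _ = contradiction (∈-resp-≐ D≐D′ (full₁ r₁<r₂ r₂<r)) gap₂
... | tri> _ _ r₂<r₁ = contradiction (∈-resp-≐ (≐-sym D≐D′) (full₂ r₂<r₁ r₁<r)) gap₁
... | tri≈ _ refl _  = moved-cong _ _ D≐D′

kohnertMove-cong : ∀ r {D D′} → D ≐ D′ → kohnertMove r D ≐ kohnertMove r D′
kohnertMove-cong r {D} {D′} D≐D′ = moveView-cong D≐D′ (moveView r D) (moveView r D′)

⇝-respˡ : ∀ {D D′ F} → D ≐ D′ → D′ ⇝ F → D ⇝ F
⇝-respˡ D≐D′ (done D′≐F)  = done (≐-trans D≐D′ D′≐F)
⇝-respˡ D≐D′ (step r path) = step r (⇝-respˡ (kohnertMove-cong r D≐D′) path)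

⇝-trans : ∀ {D E F} → D ⇝ E → E ⇝ F → D ⇝ F
⇝-trans (done D≐E)    E⇝F = ⇝-respˡ D≐E E⇝F
⇝-trans (step r path) E⇝F = step r (⇝-trans path E⇝F)

Fixed : Diagram → Set
Fixed E = ∀ r → kohnertMove r E ≐ E

fixed-⇝ : ∀ {E F} → Fixed E → E ⇝ F → F ≐ E
fixed-⇝ {E} fixed = go ≐-refl
  where
  go : ∀ {D F} → D ≐ E → D ⇝ F → F ≐ E
  go D≐E (done D≐F)    = ≐-trans (≐-sym D≐F) D≐E
  go D≐E (step r path) = go (≐-trans (kohnertMove-cong r D≐E) (fixed r)) path

FullBelowRowMaxima : Diagram → Set
FullBelowRowMaxima E = ∀ {r c} → IsRowMax E r c → ∀ {s} → 1 ≤ s → s < r → (s , c) ∈ E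

fixed⇒fullBelowRowMaxima : ∀ {E} → Fixed E → FullBelowRowMaxima E
fixed⇒fullBelowRowMaxima {E} fixed {r} max 1≤s s<r with kohnertMove r E | moveView r E | fixed r
... | _ | emptyRow ∉E          | _ = contradiction (proj₁ max) ∉E
... | _ | blocked max′ full    | _ with rowMax-unique ≐-refl max max′
...   | refl = full 1≤s s<r
fixed⇒fullBelowRowMaxima {E} fixed {r} max 1≤s s<r | _ | moves _ _ _ gap _ | moved≐E =
  contradiction (∈-resp-≐ moved≐E (here refl)) gap

fullBelowRowMaxima⇒fixed : ∀ {E} → FullBelowRowMaxima E → Fixed E
fullBelowRowMaxima⇒fixed {E} full r with kohnertMove r E | moveView r E
... | _ | emptyRow _  = ≐-refl
... | _ | blocked _ _ = ≐-refl
... | _ | moves max 1≤r′ r′<r gap _ = contradiction (full max 1≤r′ r′<r) gap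

-- Reaching a fixed diagram

-- Taken over the list, duplicates included; a move deletes every copy of its cell.
rowWeight : Diagram → ℕ
rowWeight D = sum (map proj₁ D)

private
  removeCell-reject : ∀ {x y} D → y ≡ x → removeCell x (y ∷ D) ≡ removeCell x D
  removeCell-reject {x} {y} D y≡x = filter-reject (λ z → ¬? (≡-dec _≟_ _≟_ z x)) {xs = D} (λ y≢x → y≢x y≡x)

  removeCell-accept : ∀ {x y} D → y ≢ x → removeCell x (y ∷ D) ≡ y ∷ removeCell x D
  removeCell-accept {x} {y} D y≢x = filter-accept (λ z → ¬? (≡-dec _≟_ _≟_ z x)) {xs = D} y≢x

rowWeight-removeCell-≤ : ∀ x D → rowWeight (removeCell x D) ≤ rowWeight D
rowWeight-removeCell-≤ x []      = z≤n
rowWeight-removeCell-≤ x (y ∷ D) = case (≡-dec _≟_ _≟_ y x)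
  where
  open ≤-Reasoning
  case : Dec (y ≡ x) → rowWeight (removeCell x (y ∷ D)) ≤ rowWeight (y ∷ D)
  case (yes y≡x) = begin
    rowWeight (removeCell x (y ∷ D)) ≡⟨ cong rowWeight (removeCell-reject D y≡x) ⟩
    rowWeight (removeCell x D)       ≤⟨ m≤n⇒m≤o+n (proj₁ y) (rowWeight-removeCell-≤ x D) ⟩
    proj₁ y + rowWeight D            ∎
  case (no y≢x) = begin
    rowWeight (removeCell x (y ∷ D))     ≡⟨ cong rowWeight (removeCell-accept D y≢x) ⟩
    proj₁ y + rowWeight (removeCell x D) ≤⟨ +-monoʳ-≤ (proj₁ y) (rowWeight-removeCell-≤ x D) ⟩
    proj₁ y + rowWeight D                ∎

rowWeight-removeCell : ∀ {x} D → x ∈ D → rowWeight (removeCell x D) + proj₁ x ≤ rowWeight D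
rowWeight-removeCell {x} (y ∷ D) x∈ = case (≡-dec _≟_ _≟_ y x) x∈
  where
  open ≤-Reasoning
  case : Dec (y ≡ x) → x ∈ y ∷ D → rowWeight (removeCell x (y ∷ D)) + proj₁ x ≤ rowWeight (y ∷ D)
  case (yes refl) _ = begin
    rowWeight (removeCell x (x ∷ D)) + proj₁ x ≡⟨ cong (λ E → rowWeight E + proj₁ x) (removeCell-reject D refl) ⟩
    rowWeight (removeCell x D) + proj₁ x       ≡⟨ +-comm _ (proj₁ x) ⟩
    proj₁ x + rowWeight (removeCell x D)       ≤⟨ +-monoʳ-≤ (proj₁ x) (rowWeight-removeCell-≤ x D) ⟩
    proj₁ x + rowWeight D                      ∎
  case (no y≢x) (here x≡y)  = contradiction (sym x≡y) y≢x
  case (no y≢x) (there x∈D) = begin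
    rowWeight (removeCell x (y ∷ D)) + proj₁ x       ≡⟨ cong (λ E → rowWeight E + proj₁ x) (removeCell-accept D y≢x) ⟩
    proj₁ y + rowWeight (removeCell x D) + proj₁ x   ≡⟨ +-assoc (proj₁ y) _ (proj₁ x) ⟩
    proj₁ y + (rowWeight (removeCell x D) + proj₁ x) ≤⟨ +-monoʳ-≤ (proj₁ y) (rowWeight-removeCell D x∈D) ⟩
    proj₁ y + rowWeight D                            ∎

kohnertMove-trivial⊎descends : ∀ r D → kohnertMove r D ≡ D ⊎ rowWeight (kohnertMove r D) < rowWeight D
kohnertMove-trivial⊎descends r D with kohnertMove r D | moveView r D
... | _ | emptyRow _  = inj₁ refl
... | _ | blocked _ _ = inj₁ refl
... | _ | moves {c} {r′} (r,c∈D , _) _ r′<r _ _ = inj₂ (begin-strict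
  r′ + rowWeight (removeCell (r , c) D) <⟨ +-monoˡ-< _ r′<r ⟩
  r + rowWeight (removeCell (r , c) D)  ≡⟨ +-comm r _ ⟩
  rowWeight (removeCell (r , c) D) + r  ≤⟨ rowWeight-removeCell D r,c∈D ⟩
  rowWeight D                           ∎)
  where open ≤-Reasoning

kohnertMove-unoccupied : ∀ {r} D → r ∉ map proj₁ D → kohnertMove r D ≡ D
kohnertMove-unoccupied {r} D r∉ with kohnertMove r D | moveView r D
... | _ | emptyRow _  = refl
... | _ | blocked _ _ = refl
... | _ | moves (r,c∈D , _) _ _ _ _ = contradiction (∈-map⁺ proj₁ r,c∈D) r∉

fixed⊎descends : ∀ D → Fixed D ⊎ ∃[ r ] rowWeight (kohnertMove r D) < rowWeight D
fixed⊎descends D with all? (λ r → List.≡-dec (≡-dec _≟_ _≟_) (kohnertMove r D) D) (map proj₁ D)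
... | yes trivial = inj₁ fixed
  where
  fixed : Fixed D
  fixed r with r ∈? map proj₁ D
  ... | yes r∈ = ≐-reflexive (All.lookup trivial r∈)
  ... | no  r∉ = ≐-reflexive (kohnertMove-unoccupied D r∉)
... | no nontrivial with find (¬All⇒Any¬ (λ r → List.≡-dec (≡-dec _≟_ _≟_) (kohnertMove r D) D) _ nontrivial)
... | r , _ , moved≢D with kohnertMove-trivial⊎descends r D
...   | inj₁ moved≡D = contradiction moved≡D moved≢D
...   | inj₂ descends = inj₂ (r , descends)

reachFixed : ∀ D → ∃[ E ] D ⇝ E × Fixed E
reachFixed D = go D (<-wellFounded (rowWeight D))
  where
  go : ∀ D → Acc _<_ (rowWeight D) → ∃[ E ] D ⇝ E × Fixed E
  go D (acc smaller) with fixed⊎descends D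
  ... | inj₁ fixed = D , done ≐-refl , fixed
  ... | inj₂ (r , descends) with go (kohnertMove r D) (smaller descends)
  ...   | E , path , fixed = E , step r path , fixed

-- Column counts

cellIndicator : Diagram → Cell → ℕ
cellIndicator D x = if ⌊ x ∈?ᶜ D ⌋ then 1 else 0

cellIndicator-∈ : ∀ {D x} → x ∈ D → cellIndicator D x ≡ 1
cellIndicator-∈ {D} {x} x∈D with x ∈?ᶜ D
... | yes _   = refl
... | no  x∉D = contradiction x∈D x∉D

cellIndicator-∉ : ∀ {D x} → x ∉ D → cellIndicator D x ≡ 0
cellIndicator-∉ {D} {x} x∉D with x ∈?ᶜ D
... | yes x∈D = contradiction x∈D x∉D
... | no  _   = refl

cellIndicator-≤1 : ∀ D x → cellIndicator D x ≤ 1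
cellIndicator-≤1 D x with x ∈?ᶜ D
... | yes _ = ≤-refl
... | no  _ = z≤n

cellIndicator-cong : ∀ {D E x} → (x ∈ D → x ∈ E) → (x ∈ E → x ∈ D) → cellIndicator D x ≡ cellIndicator E x
cellIndicator-cong {D} {E} {x} to from with x ∈?ᶜ D | x ∈?ᶜ E
... | yes _   | yes _   = refl
... | no  _   | no  _   = refl
... | yes x∈D | no  x∉E = contradiction (to x∈D) x∉E
... | no  x∉D | yes x∈E = contradiction (from x∈E) x∉D

cellIndicator-moved : ∀ {p q x} D → x ≢ p → x ≢ q → cellIndicator (p ∷ removeCell q D) x ≡ cellIndicator D x
cellIndicator-moved {p} {q} D x≢p x≢q = cellIndicator-cong to (λ x∈D → ∈-moved⁺ {D = D} (inj₂ (x∈D , x≢q)))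
  where
  to : _ ∈ p ∷ removeCell q D → _ ∈ D
  to x∈ with ∈-moved⁻ D x∈
  ... | inj₁ x≡p       = contradiction x≡p x≢p
  ... | inj₂ (x∈D , _) = x∈D

columnCount : ℕ → Diagram → ℕ → ℕ
columnCount N D c = sumFrom (λ s → cellIndicator D (s , c)) 1 N

module _ {D : Diagram} {r r′ c : ℕ} (r,c∈D : (r , c) ∈ D) (gap : (r′ , c) ∉ D) (r′≢r : r′ ≢ r) where
  private
    f : ℕ → ℕ
    f s = cellIndicator D (s , c)

  cellIndicator-moved-column : ∀ s → cellIndicator ((r′ , c) ∷ removeCell (r , c) D) (s , c) ≡ (f [ r ≔ f r′ ] [ r′ ≔ f r ]) s
  cellIndicator-moved-column s = case (s ≟ r′) (s ≟ r)
    where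
    open ≡-Reasoning
    case : Dec (s ≡ r′) → Dec (s ≡ r) →
           cellIndicator ((r′ , c) ∷ removeCell (r , c) D) (s , c) ≡ (f [ r ≔ f r′ ] [ r′ ≔ f r ]) s
    case (yes refl) _ = begin
      cellIndicator ((r′ , c) ∷ removeCell (r , c) D) (r′ , c) ≡⟨ cellIndicator-∈ (here refl) ⟩
      1                                                         ≡⟨ cellIndicator-∈ r,c∈D ⟨
      f r                                                       ≡⟨ update-≡ (f [ r ≔ f r′ ]) r′ (f r) ⟨
      (f [ r ≔ f r′ ] [ r′ ≔ f r ]) r′                          ∎
    case (no s≢r′) (yes refl) = begin
      cellIndicator ((r′ , c) ∷ removeCell (r , c) D) (r , c)  ≡⟨ cellIndicator-∉ r,c∉moved ⟩
      0                                                         ≡⟨ cellIndicator-∉ gap ⟨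
      f r′                                                      ≡⟨ update-≡ f r (f r′) ⟨
      (f [ r ≔ f r′ ]) r                                        ≡⟨ update-≢ (f [ r ≔ f r′ ]) (f r) s≢r′ ⟨
      (f [ r ≔ f r′ ] [ r′ ≔ f r ]) r                           ∎
      where
      r,c∉moved : (r , c) ∉ (r′ , c) ∷ removeCell (r , c) D
      r,c∉moved r,c∈ with ∈-moved⁻ D r,c∈
      ... | inj₁ r,c≡r′,c  = s≢r′ (cong proj₁ r,c≡r′,c)
      ... | inj₂ (_ , x≢x) = x≢x refl
    case (no s≢r′) (no s≢r) = begin
      cellIndicator ((r′ , c) ∷ removeCell (r , c) D) (s , c)  ≡⟨ cellIndicator-moved D (s≢r′ ∘ cong proj₁) (s≢r ∘ cong proj₁) ⟩
      f s                                                       ≡⟨ update-≢ f (f r′) s≢r ⟨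
      (f [ r ≔ f r′ ]) s                                        ≡⟨ update-≢ (f [ r ≔ f r′ ]) (f r) s≢r′ ⟨
      (f [ r ≔ f r′ ] [ r′ ≔ f r ]) s                           ∎

  columnCount-moved : ∀ {N} → 1 ≤ r → r ≤ N → 1 ≤ r′ → r′ ≤ N →
                      ∀ c′ → columnCount N ((r′ , c) ∷ removeCell (r , c) D) c′ ≡ columnCount N D c′
  columnCount-moved {N} 1≤r r≤N 1≤r′ r′≤N c′ with c′ ≟ c
  ... | yes refl = trans (sumFrom-cong 1 N (λ {s} _ _ → cellIndicator-moved-column s))
                         (sumFrom-transpose f 1 N 1≤r (s≤s r≤N) 1≤r′ (s≤s r′≤N) r′≢r)
  ... | no c′≢c = sumFrom-cong 1 N (λ _ _ → cellIndicator-moved D (c′≢c ∘ cong proj₂) (c′≢c ∘ cong proj₂))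

record HasProfile (N : ℕ) (n : ℕ → ℕ) (D : Diagram) : Set where
  field
    bounded       : ∀ {r c} → (r , c) ∈ D → 1 ≤ r × r ≤ N × 1 ≤ c
    columnCount≡ : ∀ {c} → 1 ≤ c → columnCount N D c ≡ n c

module _ {N : ℕ} {n : ℕ → ℕ} where

  HasProfile-resp-≐ : ∀ {D E} → D ≐ E → HasProfile N n D → HasProfile N n E
  HasProfile-resp-≐ D≐E prof = record
    { bounded      = λ x∈E → bounded (∈-resp-≐ (≐-sym D≐E) x∈E)
    ; columnCount≡ = λ {c} 1≤c → trans
        (sumFrom-cong 1 N (λ _ _ → cellIndicator-cong (∈-resp-≐ (≐-sym D≐E)) (∈-resp-≐ D≐E)))
        (columnCount≡ 1≤c)
    }
    where open HasProfile prof

  HasProfile-kohnertMove : ∀ r {D} → HasProfile N n D → HasProfile N n (kohnertMove r D)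
  HasProfile-kohnertMove r {D} prof with kohnertMove r D | moveView r D
  ... | _ | emptyRow _  = prof
  ... | _ | blocked _ _ = prof
  ... | _ | moves {c} {r′} (r,c∈D , _) 1≤r′ r′<r gap _ with HasProfile.bounded prof r,c∈D
  ...   | 1≤r , r≤N , 1≤c = record
    { bounded      = bounded′
    ; columnCount≡ = λ {c′} 1≤c′ → trans (columnCount-moved r,c∈D gap (<⇒≢ r′<r) 1≤r r≤N 1≤r′ r′≤N c′) (columnCount≡ 1≤c′)
    }
    where
    open HasProfile prof
    r′≤N : r′ ≤ N
    r′≤N = ≤-trans (<⇒≤ r′<r) r≤N
    bounded′ : ∀ {s c′} → (s , c′) ∈ (r′ , c) ∷ removeCell (r , c) D → 1 ≤ s × s ≤ N × 1 ≤ c′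
    bounded′ x∈ with ∈-moved⁻ D x∈
    ... | inj₁ refl       = 1≤r′ , r′≤N , 1≤c
    ... | inj₂ (x∈D , _) = bounded x∈D

  HasProfile-⇝ : ∀ {D E} → HasProfile N n D → D ⇝ E → HasProfile N n E
  HasProfile-⇝ prof (done D≐E)    = HasProfile-resp-≐ D≐E prof
  HasProfile-⇝ prof (step r path) = HasProfile-⇝ (HasProfile-kohnertMove r prof) path

downwardInduction : ∀ {ℓ} (P : ℕ → Set ℓ) N → (∀ r → (∀ {s} → r < s → s ≤ N → P s) → P r) → ∀ r → P r
downwardInduction P N stepDown r = go r (On.wellFounded (N ∸_) <-wellFounded r)
  where
  go : ∀ r → Acc (_<_ on (N ∸_)) r → P r
  go r (acc smaller) = stepDown r (λ r<s s≤N → go _ (smaller (∸-monoʳ-< r<s s≤N)))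

DownClosed : Diagram → Set
DownClosed D = ∀ {r c s} → (r , c) ∈ D → 1 ≤ s → s ≤ r → (s , c) ∈ D

downClosed⇒fullBelowRowMaxima : ∀ {D} → DownClosed D → FullBelowRowMaxima D
downClosed⇒fullBelowRowMaxima downClosed (r,c∈D , _) 1≤s s<r = downClosed r,c∈D 1≤s (<⇒≤ s<r)

module _ {N : ℕ} {D : Diagram} {c : ℕ} where

  columnCount-≥ : ∀ {k} → k ≤ N → (∀ {s} → 1 ≤ s → s ≤ k → (s , c) ∈ D) → k ≤ columnCount N D c
  columnCount-≥ {k} k≤N full = sumFrom-≥ _ 1 N k k≤N
    (λ 1≤s s≤k → ≤-reflexive (sym (cellIndicator-∈ (full 1≤s (≤-pred s≤k)))))

  columnCount-≤ : ∀ {k} → (∀ {s} → k < s → (s , c) ∉ D) → columnCount N D c ≤ k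
  columnCount-≤ {k} empty = sumFrom-≤ _ 1 N k (λ s → cellIndicator-≤1 D (s , c)) (cellIndicator-∉ ∘ empty)

  columnCount-< : ∀ {h k} → 1 ≤ h → h ≤ k → h ≤ N → (h , c) ∉ D → (∀ {s} → k < s → (s , c) ∉ D) →
                  columnCount N D c < k
  columnCount-< {h} {k} 1≤h h≤k h≤N gap empty = begin-strict
    columnCount N D c           <⟨ n<1+n _ ⟩
    1 + columnCount N D c       ≡⟨ +-comm 1 _ ⟩
    columnCount N D c + 1       ≡⟨ sumFrom-update f 1 1 N 1≤h (s≤s h≤N) ⟨
    sumFrom (f [ h ≔ 1 ]) 1 N + f h ≡⟨ cong (sumFrom (f [ h ≔ 1 ]) 1 N +_) (cellIndicator-∉ gap) ⟩
    sumFrom (f [ h ≔ 1 ]) 1 N + 0   ≡⟨ +-identityʳ _ ⟩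
    sumFrom (f [ h ≔ 1 ]) 1 N   ≤⟨ sumFrom-≤ (f [ h ≔ 1 ]) 1 N k ≤1 vanish ⟩
    k                           ∎
    where
    open ≤-Reasoning
    f : ℕ → ℕ
    f s = cellIndicator D (s , c)
    ≤1 : ∀ s → (f [ h ≔ 1 ]) s ≤ 1
    ≤1 s with s ≟ h
    ... | yes _ = ≤-refl
    ... | no  _ = cellIndicator-≤1 D (s , c)
    vanish : ∀ {s} → k < s → (f [ h ≔ 1 ]) s ≡ 0
    vanish {s} k<s = trans (update-≢ f 1 (λ { refl → <⇒≱ k<s h≤k })) (cellIndicator-∉ (empty k<s))

module _ {N : ℕ} {n : ℕ → ℕ} (antitone : ∀ {c d} → 1 ≤ c → c ≤ d → n d ≤ n c)
         {D : Diagram} (prof : HasProfile N n D) (full : FullBelowRowMaxima D) where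
  open HasProfile prof

  fullBelowRowMaxima⇒downClosed : DownClosed D
  fullBelowRowMaxima⇒downClosed {r} r,c∈D = downwardInduction ClosedBelow N closedBelow r r,c∈D
    where
    ClosedBelow : ℕ → Set
    ClosedBelow r = ∀ {c} → (r , c) ∈ D → ∀ {s} → 1 ≤ s → s ≤ r → (s , c) ∈ D

    closedBelow : ∀ r → (∀ {t} → r < t → t ≤ N → ClosedBelow t) → ClosedBelow r
    closedBelow r above {c} r,c∈D {s} 1≤s s≤r with (s , c) ∈?ᶜ D
    ... | yes s,c∈D = s,c∈D
    ... | no  gap   with bounded r,c∈D | rowMax-exists r,c∈D
    ...   | 1≤r , r≤N , 1≤c | d , max , c≤d = contradiction (begin
      r                     ≤⟨ columnCount-≥ r≤N columnFull ⟩
      columnCount N D d     ≡⟨ columnCount≡ (≤-trans 1≤c c≤d) ⟩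
      n d                   ≤⟨ antitone 1≤c c≤d ⟩
      n c                   ≡⟨ columnCount≡ 1≤c ⟨
      columnCount N D c     ∎) (<⇒≱ (columnCount-< 1≤s s≤r (≤-trans s≤r r≤N) gap emptyAbove))
      where
      open ≤-Reasoning
      columnFull : ∀ {s′} → 1 ≤ s′ → s′ ≤ r → (s′ , d) ∈ D
      columnFull 1≤s′ s′≤r with m≤n⇒m<n∨m≡n s′≤r
      ... | inj₁ s′<r = full max 1≤s′ s′<r
      ... | inj₂ refl = proj₁ max
      emptyAbove : ∀ {t} → r < t → (t , c) ∉ D
      emptyAbove r<t t,c∈D = gap (above r<t (proj₁ (proj₂ (bounded t,c∈D))) t,c∈D 1≤s (≤-trans s≤r (<⇒≤ r<t)))

  ∈⇔≤height : ∀ {r c} → (r , c) ∈ D ⇔ (1 ≤ r × 1 ≤ c × r ≤ n c)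
  ∈⇔≤height {r} {c} = mk⇔ to from
    where
    to : (r , c) ∈ D → 1 ≤ r × 1 ≤ c × r ≤ n c
    to r,c∈D with bounded r,c∈D
    ... | 1≤r , r≤N , 1≤c = 1≤r , 1≤c , subst (r ≤_) (columnCount≡ 1≤c)
      (columnCount-≥ r≤N (fullBelowRowMaxima⇒downClosed r,c∈D))
    from : ∀ {r} → 1 ≤ r × 1 ≤ c × r ≤ n c → (r , c) ∈ D
    from {suc r₀} (_ , 1≤c , r≤nc) with (suc r₀ , c) ∈?ᶜ D
    ... | yes r,c∈D = r,c∈D
    ... | no  gap   = contradiction r≤nc (<⇒≱ (s≤s (subst (_≤ r₀) (columnCount≡ 1≤c) (columnCount-≤ {N} emptyAbove))))
      where
      emptyAbove : ∀ {s} → r₀ < s → (s , c) ∉ D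
      emptyAbove r₀<s s,c∈D = gap (fullBelowRowMaxima⇒downClosed s,c∈D (s≤s z≤n) r₀<s)

fullBelowRowMaxima-unique : ∀ {N n D E} → (∀ {c d} → 1 ≤ c → c ≤ d → n d ≤ n c) →
                            HasProfile N n D → FullBelowRowMaxima D →
                            HasProfile N n E → FullBelowRowMaxima E → D ≐ E
fullBelowRowMaxima-unique antitone profD fullD profE fullE (r , c) =
  ⇔.trans (∈⇔≤height antitone profD fullD) (⇔.sym (∈⇔≤height antitone profE fullE))

-- Key diagrams

rowLength : List ℕ → ℕ → ℕ → ℕ
rowLength []       i r = 0
rowLength (x ∷ xs) i r with r ≟ i
... | yes _ = x
... | no  _ = rowLength xs (suc i) r

rowLength-here : ∀ x xs i → rowLength (x ∷ xs) i i ≡ x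
rowLength-here x xs i with i ≟ i
... | yes _  = refl
... | no i≢i = contradiction refl i≢i

rowLength-there : ∀ x xs {i r} → r ≢ i → rowLength (x ∷ xs) i r ≡ rowLength xs (suc i) r
rowLength-there x xs {i} {r} r≢i with r ≟ i
... | yes r≡i = contradiction r≡i r≢i
... | no  _   = refl

rowLength-support : ∀ xs i {r} → 1 ≤ rowLength xs i r → i ≤ r × r < i + length xs
rowLength-support (x ∷ xs) i {r} pos with r ≟ i
... | yes refl = ≤-refl , m<m+n r z<s
... | no  _    with rowLength-support xs (suc i) pos
...   | i<r , r<hi = <⇒≤ i<r , subst (r <_) (sym (+-suc i (length xs))) r<hi

∈-keyFrom⁻ : ∀ xs i {r c} → (r , c) ∈ keyFrom i xs → 1 ≤ c × c ≤ rowLength xs i r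
∈-keyFrom⁻ (x ∷ xs) i {r} r,c∈ with ∈-++⁻ (rowCells i x) r,c∈
... | inj₁ r,c∈row with ∈-map⁻ (λ j → (i , suc j)) r,c∈row
...   | j , j∈ , refl = s≤s z≤n , subst (suc j ≤_) (sym (rowLength-here x xs i)) (∈-upTo⁻ j∈)
∈-keyFrom⁻ (x ∷ xs) i {r} r,c∈ | inj₂ r,c∈rest with ∈-keyFrom⁻ xs (suc i) r,c∈rest
... | 1≤c , c≤len = 1≤c , subst (_ ≤_) (sym (rowLength-there x xs r≢i)) c≤len
  where
  r≢i : r ≢ i
  r≢i refl = <-irrefl refl (proj₁ (rowLength-support xs (suc r) (≤-trans 1≤c c≤len)))

∈-keyFrom⁺ : ∀ xs i {r c} → 1 ≤ c → c ≤ rowLength xs i r → (r , c) ∈ keyFrom i xs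
∈-keyFrom⁺ (x ∷ xs) i {r} {suc c} 1≤c c≤len with r ≟ i
... | yes refl = ∈-++⁺ˡ (∈-map⁺ (λ j → (r , suc j)) (∈-upTo⁺ c≤len))
... | no  _    = ∈-++⁺ʳ (rowCells i x) (∈-keyFrom⁺ xs (suc i) 1≤c c≤len)


keyFrom-shift : ∀ x xs {i s c} → s ≢ i → (s , c) ∈ keyFrom i (x ∷ xs) ⇔ (s , c) ∈ keyFrom (suc i) xs
keyFrom-shift x xs {i} {s} {c} s≢i = mk⇔
  (λ s,c∈ → let 1≤c , c≤len = ∈-keyFrom⁻ (x ∷ xs) i s,c∈ in
            ∈-keyFrom⁺ xs (suc i) 1≤c (subst (c ≤_) (rowLength-there x xs s≢i) c≤len))
  (λ s,c∈ → let 1≤c , c≤len = ∈-keyFrom⁻ xs (suc i) s,c∈ in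
            ∈-keyFrom⁺ (x ∷ xs) i 1≤c (subst (c ≤_) (sym (rowLength-there x xs s≢i)) c≤len))

partsAtLeast : ℕ → List ℕ → ℕ
partsAtLeast c xs = length (filter (c ≤?_) xs)

keyFrom-columnCount : ∀ xs i {c} → 1 ≤ c →
  sumFrom (λ s → cellIndicator (keyFrom i xs) (s , c)) i (length xs) ≡ partsAtLeast c xs
keyFrom-columnCount []       i 1≤c = refl
keyFrom-columnCount (x ∷ xs) i {c} 1≤c = case (c ≤? x)
  where
  rest : sumFrom (λ s → cellIndicator (keyFrom i (x ∷ xs)) (s , c)) (suc i) (length xs) ≡ partsAtLeast c xs
  rest = trans (sumFrom-cong (suc i) (length xs) (λ i<s _ → cellIndicator-cong
                  (Equivalence.to (keyFrom-shift x xs (>⇒≢ i<s))) (Equivalence.from (keyFrom-shift x xs (>⇒≢ i<s)))))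
               (keyFrom-columnCount xs (suc i) 1≤c)
  case : Dec (c ≤ x) → _ ≡ partsAtLeast c (x ∷ xs)
  case (yes c≤x) = trans
    (cong₂ _+_ (cellIndicator-∈ (∈-keyFrom⁺ (x ∷ xs) i 1≤c (subst (c ≤_) (sym (rowLength-here x xs i)) c≤x))) rest)
    (sym (cong length (filter-accept (c ≤?_) c≤x)))
  case (no c≰x) = trans
    (cong₂ _+_ (cellIndicator-∉ (λ i,c∈ → c≰x (subst (c ≤_) (rowLength-here x xs i) (proj₂ (∈-keyFrom⁻ (x ∷ xs) i i,c∈))))) rest)
    (sym (cong length (filter-reject (c ≤?_) c≰x)))

partsAtLeast-antitone : ∀ xs {c d} → c ≤ d → partsAtLeast d xs ≤ partsAtLeast c xs
partsAtLeast-antitone xs c≤d =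
  Sublist.length-mono-≤ (Sublist.filter⁺ (_ ≤?_) (_ ≤?_) (λ { refl d≤x → ≤-trans c≤d d≤x }) (⊆-refl {x = xs}))

keyDiagram-profile : ∀ xs → HasProfile (length xs) (λ c → partsAtLeast c xs) (keyDiagram xs)
keyDiagram-profile xs = record
  { bounded      = bounded
  ; columnCount≡ = keyFrom-columnCount xs 1
  }
  where
  bounded : ∀ {r c} → (r , c) ∈ keyDiagram xs → 1 ≤ r × r ≤ length xs × 1 ≤ c
  bounded r,c∈ with ∈-keyFrom⁻ xs 1 r,c∈
  ... | 1≤c , c≤len with rowLength-support xs 1 (≤-trans 1≤c c≤len)
  ...   | 1≤r , r<1+len = 1≤r , ≤-pred r<1+len , 1≤c

keyDiagram-profile-↭ : ∀ {xs ys} → xs ↭ ys → HasProfile (length ys) (λ c → partsAtLeast c ys) (keyDiagram xs)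
keyDiagram-profile-↭ {xs} {ys} xs↭ys = subst (λ N → HasProfile N _ (keyDiagram xs)) (↭-length xs↭ys) (record
  { bounded      = bounded
  ; columnCount≡ = λ 1≤c → trans (columnCount≡ 1≤c) (↭-length (filter-↭ (_ ≤?_) xs↭ys))
  })
  where open HasProfile (keyDiagram-profile xs)

rowLength-≤ : ∀ {x} xs → All.All (_≤ x) xs → ∀ i r → rowLength xs i r ≤ x
rowLength-≤ []       All.[]            i r = z≤n
rowLength-≤ (y ∷ ys) (y≤x All.∷ ys≤x) i r with r ≟ i
... | yes _ = y≤x
... | no  _ = rowLength-≤ ys ys≤x (suc i) r

rowLength-antitone : ∀ {xs} → AllPairs _≥_ xs → ∀ i {s r} → i ≤ s → s ≤ r → rowLength xs i r ≤ rowLength xs i s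
rowLength-antitone {[]}     []                i i≤s s≤r = z≤n
rowLength-antitone {x ∷ xs} (x≥xs ∷ sorted) i {s} {r} i≤s s≤r with m≤n⇒m<n∨m≡n i≤s
... | inj₂ refl = subst (rowLength (x ∷ xs) s r ≤_) (sym (rowLength-here x xs s)) (rowLength-≤ (x ∷ xs) (≤-refl All.∷ x≥xs) s r)
... | inj₁ i<s = begin
  rowLength (x ∷ xs) i r   ≡⟨ rowLength-there x xs (>⇒≢ (<-≤-trans i<s s≤r)) ⟩
  rowLength xs (suc i) r   ≤⟨ rowLength-antitone sorted (suc i) i<s s≤r ⟩
  rowLength xs (suc i) s   ≡⟨ rowLength-there x xs (>⇒≢ i<s) ⟨
  rowLength (x ∷ xs) i s   ∎
  where open ≤-Reasoning

keyDiagram-downClosed : ∀ {xs} → AllPairs _≥_ xs → DownClosed (keyDiagram xs)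
keyDiagram-downClosed {xs} sorted r,c∈ 1≤s s≤r with ∈-keyFrom⁻ xs 1 r,c∈
... | 1≤c , c≤len = ∈-keyFrom⁺ xs 1 1≤c (≤-trans c≤len (rowLength-antitone sorted 1 1≤s s≤r))

All-reverse : ∀ {P : ℕ → Set} {xs} → All.All P xs → All.All P (reverse xs)
All-reverse ps = All.tabulate (λ x∈ → All.lookup ps (Any.reverse⁻ x∈))

AllPairs-reverse : ∀ {R : ℕ → ℕ → Set} {xs} → AllPairs R xs → AllPairs (flip R) (reverse xs)
AllPairs-reverse {xs = []}     []               = []
AllPairs-reverse {xs = x ∷ xs} (Rx-xs ∷ sorted) = subst (AllPairs _) (sym (unfold-reverse x xs))
  (AllPairs.++⁺ (AllPairs-reverse sorted) (All.[] ∷ []) (All.map (All._∷ All.[]) (All-reverse Rx-xs)))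

sortDesc-↭ : ∀ a → sortDesc a ↭ a
sortDesc-↭ a = ↭-trans (↭-reverse _) (Sort.sort-↭ ≤-decTotalOrder a)

sortDesc-descending : ∀ a → AllPairs _≥_ (sortDesc a)
sortDesc-descending a = AllPairs-reverse (Linked⇒AllPairs ≤-trans (Sort.sort-↗ ≤-decTotalOrder a))

minimal⇒fixed : ∀ {D₀ E} → IsMinimal D₀ E → Fixed E
minimal⇒fixed {E = E} (D₀⇝E , minimal) r = minimal (kohnertMove r E) (⇝-trans D₀⇝E oneMove) oneMove
  where
  oneMove : E ⇝ kohnertMove r E
  oneMove = step r (done ≐-refl)

sortedKeyDiagram-fullBelowRowMaxima : ∀ a → FullBelowRowMaxima (keyDiagram (sortDesc a))
sortedKeyDiagram-fullBelowRowMaxima a = downClosed⇒fullBelowRowMaxima (keyDiagram-downClosed (sortDesc-descending a))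

fixed-≐-sortedKeyDiagram : ∀ a {E} → keyDiagram a ⇝ E → Fixed E → E ≐ keyDiagram (sortDesc a)
fixed-≐-sortedKeyDiagram a D₀⇝E fixed = fullBelowRowMaxima-unique (λ _ → partsAtLeast-antitone a)
  (HasProfile-⇝ (keyDiagram-profile a) D₀⇝E) (fixed⇒fullBelowRowMaxima fixed)
  (keyDiagram-profile-↭ (sortDesc-↭ a)) (sortedKeyDiagram-fullBelowRowMaxima a)

corollary6p2 : (a : WeakComposition) → IsUniqueMinimal (keyDiagram a) (keyDiagram (sortDesc a))
corollary6p2 a with reachFixed (keyDiagram a)
... | E , D₀⇝E , fixedE = (D₀⇝M , λ _ _ → fixed-⇝ fixedM) , unique
  where
  D₀⇝M : keyDiagram a ⇝ keyDiagram (sortDesc a)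
  D₀⇝M = ⇝-trans D₀⇝E (done (fixed-≐-sortedKeyDiagram a D₀⇝E fixedE))
  fixedM : Fixed (keyDiagram (sortDesc a))
  fixedM = fullBelowRowMaxima⇒fixed (sortedKeyDiagram-fullBelowRowMaxima a)
  unique : ∀ E′ → IsMinimal (keyDiagram a) E′ → E′ ≐ keyDiagram (sortDesc a)
  unique E′ minimal = fixed-≐-sortedKeyDiagram a (proj₁ minimal) (minimal⇒fixed minimal)
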